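{- Let $S$ be a colored string of length $n$ with coloring $f$, fix a color $y$, and let $\mathcal{T}$ be the suffix tree of $S^{\mathrm{rev}}\$$. For every node $u$ of $\mathcal{T}$ and every integer $d\ge 0$: $h(u,d+1)=d$ if and only if $u$ is $(y,d)$-unique.
   Context: A colored string is a string $S=S[1,n]$ over a finite alphabet $\Sigma$ with a coloring $f:\{1,\ldots,n\}\to\Gamma$, $\Gamma$ finite; $S^{\mathrm{rev}}=S[n]\cdots S[1]$ has coloring $f^{\mathrm{rev}}(i)=f(n-i+1)$. In the suffix tree $\mathcal{T}$ of $S^{\mathrm{rev}}\$$ ($\$\notin\Sigma$), each of the $n+1$ leaves $v$ carries the label $\mathit{ln}(v)\in\{1,\ldots,n+1\}$, the starting position in $S^{\mathrm{rev}}\$$ of the suffix it represents. For a positive integer $\ell$ define $h(u,\ell)$ recursively: if $u$ is a leaf, let $j=n-\mathit{ln}(u)+1$; if $\mathit{ln}(u)<\ell$ then $h(u,\ell)=\ell-1$; otherwise, if there exists an integer $i$ with $0\le i<\ell$, $1\le j+i\le n$ and $f(j+i)=y$, then $h(u,\ell)$ is the largest such $i$; otherwise $h(u,\ell)=-1$. If $u$ is an internal node, $h(u,\ell)=\min\{h(v,\ell): v \text{ a child of } u\}$. A node $u$ is called $(y,d)$-unique if every leaf $v$ in the subtree rooted at $u$ (just $u$ itself if $u$ is a leaf) satisfies $\mathit{ln}(v)\le d$, or $\mathit{ln}(v)-d\le n$ and $f^{\mathrm{rev}}(\mathit{ln}(v)-d)=y$. (For a non-root internal node $u$ this is equivalent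 to the string $L(u)^{\mathrm{rev}}$, where $L(u)$ is the root-to-$u$ path label, being $(y,d)$-unique in $S$, i.e. every occurrence $i$ of it in $S$, of length $m$, satisfies $f(i+m-1+d)=y$ or $i+m-1+d>n$.) -}

module Defs where

open import Data.Nat using (ℕ; zero; suc; _+_; _∸_; _≤_; _<_; _<?_)
open import Data.Integer using (ℤ; +_; -[1+_]; _⊓_)
open import Data.Fin using (Fin; fromℕ<; opposite; _≟_)
open import Data.List using (List; []; _∷_; _++_; [_]; map; drop; length; upTo; head; allFin)
open import Data.List.Membership.Propositional using (_∈_)
open import Data.List.Relation.Unary.All using (All)
open import Data.List.Relation.Unary.AllPairs using (AllPairs)
open import Data.List.Relation.Binary.Permutation.Propositional using (_↭_)
open import Data.Maybe using (Maybe; just; nothing)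
open import Data.Maybe.Properties using (≡-dec)
open import Data.Product using (_×_; _,_; proj₁)
open import Data.Sum using (_⊎_)
open import Data.Bool using (Bool; true; false; if_then_else_)
open import Relation.Nullary using (yes; no; does)
open import Relation.Binary.PropositionalEquality using (_≡_; _≢_)

-- A string S of length n is  S : Fin n → Fin σ ; position p ∈ {1..n}
-- corresponds to index p-1.  A coloring is  f : Fin n → Fin γ.

-- colorAt c k : the colour at (1-based) position k, or nothing if k ∉ {1..n}.
colorAt : ∀ {n γ} → (Fin n → Fin γ) → ℕ → Maybe (Fin γ)
colorAt c zero = nothing
colorAt {n} c (suc k) with k <? n
... | yes k<n = just (c (fromℕ< k<n))
... | no  _   = nothing

rev : ∀ {n} {B : Set} → (Fin n → B) → (Fin n → B)
rev c i = c (opposite i)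

-- S^rev $ as a list over Maybe Σ, where nothing plays the role of $.
revDollar : ∀ {n σ} → (Fin n → Fin σ) → List (Maybe (Fin σ))
revDollar {n} S = map (λ i → just (rev S i)) (allFin n) ++ [ nothing ]

data Tree (A : Set) : Set where
  leaf : ℕ → Tree A
  node : List (List A × Tree A) → Tree A

module _ {A : Set} where

  leaves : Tree A → List ℕ
  leavesE : List (List A × Tree A) → List ℕ
  leaves (leaf k) = [ k ]
  leaves (node es) = leavesE es
  leavesE [] = []
  leavesE ((_ , t) ∷ es) = leaves t ++ leavesE es

  data LeafPath : Tree A → List A → ℕ → Set where
    atLeaf  : ∀ {k} → LeafPath (leaf k) [] k
    viaEdge : ∀ {es l t p k} → (l , t) ∈ es → LeafPath t p k →
              LeafPath (node es) (l ++ p) k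

  data _≺_ (u : Tree A) : Tree A → Set where
    child : ∀ {es l t} → (l , t) ∈ es → u ≡ t → u ≺ node es
    below : ∀ {es l t} → (l , t) ∈ es → u ≺ t → u ≺ node es

  _≼_ : Tree A → Tree A → Set
  u ≼ T = u ≡ T ⊎ u ≺ T

  -- Suffix tree of a string X (whose last symbol is a unique terminator):
  -- compacted trie whose leaves are labelled 1..|X| by the starting
  -- positions of the suffixes their root-to-leaf paths spell.
  record IsSuffixTree (X : List A) (T : Tree A) : Set where
    field
      leaf-labels    : leaves T ↭ map suc (upTo (length X))
      leaf-paths     : ∀ {p k} → LeafPath T p k → p ≡ drop (k ∸ 1) X
      edges-nonempty : ∀ {es} → node es ≼ T → All (λ e → proj₁ e ≢ []) es
      edges-distinct : ∀ {es} → node es ≼ T →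
                       AllPairs (λ e e′ → head (proj₁ e) ≢ head (proj₁ e′)) es
      branching      : ∀ {es} → node es ≺ T → 2 ≤ length es

lastHit : ℕ → (ℕ → Bool) → ℤ
lastHit zero p = -[1+ 0 ]
lastHit (suc m) p = if p m then + m else lastHit m p

module _ {n σ γ : ℕ} (f : Fin n → Fin γ) (y : Fin γ) where

  isY : Maybe (Fin γ) → Bool
  isY c = does (≡-dec _≟_ c (just y))

  -- leaf case: leaf label ln, j = n - ln + 1
  hLeaf : ℕ → ℕ → ℤ
  hLeaf ln ℓ with ln <? ℓ
  ... | yes _ = + (ℓ ∸ 1)
  ... | no  _ = lastHit ℓ (λ i → isY (colorAt f ((n + 1 ∸ ln) + i)))

  -- internal node: minimum over children (children lists of suffix-tree
  -- nodes are non-empty; the seed ℓ-1 is an upper bound of every h-value)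
  h  : Tree (Maybe (Fin σ)) → ℕ → ℤ
  hE : List (List (Maybe (Fin σ)) × Tree (Maybe (Fin σ))) → ℕ → ℤ
  h (leaf ln) ℓ = hLeaf ln ℓ
  h (node es) ℓ = hE es ℓ
  hE [] ℓ = + (ℓ ∸ 1)
  hE ((_ , t) ∷ es) ℓ = h t ℓ ⊓ hE es ℓ

  Unique : ℕ → Tree (Maybe (Fin σ)) → Set
  Unique d u = All (λ ln → ln ≤ d ⊎ colorAt (rev f) (ln ∸ d) ≡ just y) (leaves u)

-- Every value h(u, d + 1) is at most d, so h(u, d + 1) = d, a minimum over the leaves below u,
-- holds iff it holds at every leaf.  A leaf labelled ln ≤ d gets h = d by definition; for ln > d,
-- h = d iff position n + 1 − ln + d of S has colour y, and that is position ln − d of S^rev.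

module Submission where

open import Defs
open import Level using (0ℓ)
open import Data.Nat using (ℕ; suc; zero; _+_; _∸_; _≤_; _<_; _<?_; s≤s)
open import Data.Nat.Properties
  using (≤-trans; ≤-reflexive; +-identityʳ; ≮⇒≥; n≤1+n; n≮n; suc-injective; +-comm; +-assoc; +-suc;
         m∸n+n≡m; m+[n∸m]≡n; m+n∸m≡n; m≤m+n; m≤n+m)
open import Data.Integer using (ℤ; +_; _⊓_; +≤+; -≤+) renaming (_≤_ to _≤ℤ_)
import Data.Integer.Properties as ℤ
open import Data.Fin using (Fin; fromℕ<; opposite; toℕ; _≟_)
open import Data.Fin.Properties using (toℕ-injective; toℕ-fromℕ<; opposite-prop)
open import Data.Maybe using (Maybe; just; nothing)
open import Data.Maybe.Properties using (≡-dec)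
open import Data.Bool using (Bool; true; false)
open import Data.List using (List; []; _∷_; _++_; [_]; map; length; allFin)
open import Data.List.Properties using (length-++; length-map; length-tabulate)
open import Data.List.Membership.Propositional using (_∈_)
open import Data.List.Relation.Binary.Subset.Propositional using (_⊆_)
open import Data.List.Membership.Propositional.Properties using (∈-++⁺ˡ; ∈-++⁺ʳ; ∈-map⁻; ∈-upTo⁻)
open import Data.List.Relation.Unary.Any using (here; there)
open import Data.List.Relation.Unary.All using (All; []; _∷_; tabulate)
open import Data.List.Relation.Unary.All.Properties using (++↔; ++⁻; singleton⁻)
open import Data.List.Relation.Binary.Permutation.Propositional.Properties using (∈-resp-↭)
open import Data.Product using (_×_; _,_)
open import Data.Product.Function.NonDependent.Propositional using (_×-⇔_)
open import Data.Sum using (_⊎_; inj₁; inj₂; [_,_]′)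
open import Function.Base using (_∘_; id; case_of_)
open import Function.Bundles using (_⇔_; mk⇔; Equivalence)
open import Function.Properties.Inverse using (↔⇒⇔)
open import Function.Properties.Equivalence using (⇔-setoid)
open import Relation.Nullary using (Dec; yes; no; does; contradiction)
open import Relation.Binary.PropositionalEquality using (_≡_; refl; sym; trans; cong; subst; module ≡-Reasoning)
import Relation.Binary.Reasoning.Setoid as SetoidReasoning

module ⇔-Reasoning = SetoidReasoning (⇔-setoid 0ℓ)

does≡true⇔ : ∀ {A : Set} (a? : Dec A) → does a? ≡ true ⇔ A
does≡true⇔ (yes a) = mk⇔ (λ _ → a) (λ _ → refl)
does≡true⇔ (no ¬a) = mk⇔ (λ ()) (λ a → contradiction a ¬a)

⊓≡upper⇔ : ∀ {a b c : ℤ} → a ≤ℤ c → b ≤ℤ c → a ⊓ b ≡ c ⇔ (a ≡ c × b ≡ c)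
⊓≡upper⇔ {a} {b} {c} a≤c b≤c = mk⇔ to from
  where
  to : a ⊓ b ≡ c → a ≡ c × b ≡ c
  to eq = ℤ.≤-antisym a≤c (subst (_≤ℤ a) eq (ℤ.i⊓j≤i a b))
        , ℤ.≤-antisym b≤c (subst (_≤ℤ b) eq (ℤ.i⊓j≤j a b))
  from : a ≡ c × b ≡ c → a ⊓ b ≡ c
  from (refl , refl) = ℤ.⊓-idem c

lastHit≤ : ∀ m (p : ℕ → Bool) → lastHit (suc m) p ≤ℤ + m
lastHit≤ m p with p m
... | true = ℤ.≤-refl
lastHit≤ zero p | false = -≤+
lastHit≤ (suc m) p | false = ℤ.≤-trans (lastHit≤ m p) (+≤+ (n≤1+n m))

lastHit≡max⇔ : ∀ m (p : ℕ → Bool) → lastHit (suc m) p ≡ + m ⇔ p m ≡ true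
lastHit≡max⇔ m p = mk⇔ (to m) from
  where
  to : ∀ m → lastHit (suc m) p ≡ + m → p m ≡ true
  to m eq with p m
  ... | true = refl
  to zero () | false
  to (suc m) eq | false =
    contradiction (ℤ.drop‿+≤+ (subst (_≤ℤ + m) eq (lastHit≤ m p))) (n≮n m)
  from : p m ≡ true → lastHit (suc m) p ≡ + m
  from eq rewrite eq = refl

module _ {n γ : ℕ} where

  colorAt-inside : ∀ (c : Fin n → Fin γ) {k} (k<n : k < n) →
                   colorAt c (suc k) ≡ just (c (fromℕ< k<n))
  colorAt-inside c {k} k<n with k <? n
  ... | yes _ = refl
  ... | no k≮n = contradiction k<n k≮n

  colorAt-outside : ∀ (c : Fin n → Fin γ) {k} → n ≤ k → colorAt c (suc k) ≡ nothing
  colorAt-outside c {k} n≤k with k <? n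
  ... | yes k<n = contradiction (≤-trans k<n n≤k) (n≮n k)
  ... | no _ = refl

  colorAt-rev : ∀ (c : Fin n → Fin γ) k m → k + m ≡ suc n → colorAt c m ≡ colorAt (rev c) k
  colorAt-rev c (suc k) zero eq =
    sym (colorAt-outside (rev c) (≤-reflexive (trans (sym (suc-injective eq)) (+-identityʳ k))))
  colorAt-rev c zero (suc m) eq = colorAt-outside c (≤-reflexive (suc-injective (sym eq)))
  colorAt-rev c (suc k) (suc m) eq = begin
    colorAt c (suc m)                    ≡⟨ colorAt-inside c m<n ⟩
    just (c (fromℕ< m<n))                ≡⟨ cong (just ∘ c) m≡opposite-k ⟩
    just (c (opposite (fromℕ< k<n)))     ≡⟨ colorAt-inside (rev c) k<n ⟨
    colorAt (rev c) (suc k)              ∎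
    where
    open ≡-Reasoning
    n≡1+k+m : n ≡ suc k + m
    n≡1+k+m = trans (sym (suc-injective eq)) (+-suc k m)
    k<n : k < n
    k<n = subst (k <_) (sym n≡1+k+m) (s≤s (m≤m+n k m))
    m<n : m < n
    m<n = subst (m <_) (sym n≡1+k+m) (s≤s (m≤n+m m k))
    m≡opposite-k : fromℕ< m<n ≡ opposite (fromℕ< k<n)
    m≡opposite-k = toℕ-injective (begin
      toℕ (fromℕ< m<n)              ≡⟨ toℕ-fromℕ< m<n ⟩
      m                             ≡⟨ m+n∸m≡n (suc k) m ⟨
      suc k + m ∸ suc k             ≡⟨ cong (_∸ suc k) n≡1+k+m ⟨
      n ∸ suc k                     ≡⟨ cong (λ i → n ∸ suc i) (toℕ-fromℕ< k<n) ⟨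
      n ∸ suc (toℕ (fromℕ< k<n))    ≡⟨ opposite-prop (fromℕ< k<n) ⟨
      toℕ (opposite (fromℕ< k<n))   ∎)

module _ {A : Set} where

  leavesE-⊇ : ∀ {es : List (List A × Tree A)} {l t} → (l , t) ∈ es → leaves t ⊆ leavesE es
  leavesE-⊇ {(_ , t) ∷ _} (here refl) = ∈-++⁺ˡ
  leavesE-⊇ {(_ , t) ∷ _} (there e∈es) = ∈-++⁺ʳ (leaves t) ∘ leavesE-⊇ e∈es

  ≺⇒leaves-⊆ : ∀ {u T : Tree A} → u ≺ T → leaves u ⊆ leaves T
  ≺⇒leaves-⊆ (child e∈es refl) = leavesE-⊇ e∈es
  ≺⇒leaves-⊆ (below e∈es u≺t) = leavesE-⊇ e∈es ∘ ≺⇒leaves-⊆ u≺t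

  ≼⇒leaves-⊆ : ∀ {u T : Tree A} → u ≼ T → leaves u ⊆ leaves T
  ≼⇒leaves-⊆ (inj₁ refl) = id
  ≼⇒leaves-⊆ (inj₂ u≺T) = ≺⇒leaves-⊆ u≺T

  suffixTree-leaves≤ : ∀ {X : List A} {T u : Tree A} → IsSuffixTree X T → u ≼ T →
                       All (_≤ length X) (leaves u)
  suffixTree-leaves≤ isST u≼T = tabulate λ k∈u →
    case ∈-map⁻ suc (∈-resp-↭ (IsSuffixTree.leaf-labels isST) (≼⇒leaves-⊆ u≼T k∈u)) of λ where
      (_ , i∈ , refl) → ∈-upTo⁻ i∈

length-revDollar : ∀ {n σ} (S : Fin n → Fin σ) → length (revDollar S) ≡ suc n
length-revDollar {n} S = begin
  length (map _ (allFin n) ++ [ nothing ])   ≡⟨ length-++ (map _ (allFin n)) ⟩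
  length (map _ (allFin n)) + 1              ≡⟨ cong (_+ 1) (length-map _ (allFin n)) ⟩
  length (allFin n) + 1                      ≡⟨ cong (_+ 1) (length-tabulate id) ⟩
  n + 1                                      ≡⟨ +-comm n 1 ⟩
  suc n                                      ∎
  where open ≡-Reasoning

[n∸m]+[[o∸n]+m]≡o : ∀ {m n o} → m ≤ n → n ≤ o → (n ∸ m) + ((o ∸ n) + m) ≡ o
[n∸m]+[[o∸n]+m]≡o {m} {n} {o} m≤n n≤o = begin
  (n ∸ m) + ((o ∸ n) + m)   ≡⟨ cong (λ k → (n ∸ m) + k) (+-comm (o ∸ n) m) ⟩
  (n ∸ m) + (m + (o ∸ n))   ≡⟨ +-assoc (n ∸ m) m (o ∸ n) ⟨
  (n ∸ m) + m + (o ∸ n)     ≡⟨ cong (_+ (o ∸ n)) (m∸n+n≡m m≤n) ⟩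
  n + (o ∸ n)               ≡⟨ m+[n∸m]≡n n≤o ⟩
  o                         ∎
  where open ≡-Reasoning

module _ {n σ γ : ℕ} (f : Fin n → Fin γ) (y : Fin γ) where

  private
    Node : Set
    Node = Tree (Maybe (Fin σ))
    Edges : Set
    Edges = List (List (Maybe (Fin σ)) × Node)

  isY≡true⇔ : ∀ c → isY {σ = σ} f y c ≡ true ⇔ c ≡ just y
  isY≡true⇔ c = does≡true⇔ (≡-dec _≟_ c (just y))

  h≤ : ∀ (u : Node) ℓ → h f y u (suc ℓ) ≤ℤ + ℓ
  hE≤ : ∀ (es : Edges) ℓ → hE f y es (suc ℓ) ≤ℤ + ℓ
  h≤ (leaf ln) ℓ with ln <? suc ℓ
  ... | yes _ = ℤ.≤-refl
  ... | no _ = lastHit≤ ℓ _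
  h≤ (node es) ℓ = hE≤ es ℓ
  hE≤ [] ℓ = ℤ.≤-refl
  hE≤ ((_ , t) ∷ es) ℓ = ℤ.≤-trans (ℤ.i⊓j≤i _ _) (h≤ t ℓ)

  hLeaf≡⇔ : ∀ {ln} d → ln ≤ suc n →
            hLeaf {σ = σ} f y ln (suc d) ≡ + d ⇔ (ln ≤ d ⊎ colorAt (rev f) (ln ∸ d) ≡ just y)
  hLeaf≡⇔ {ln} d ln≤1+n with ln <? suc d
  ... | yes (s≤s ln≤d) = mk⇔ (λ _ → inj₁ ln≤d) (λ _ → refl)
  ... | no ln≮1+d = begin
    lastHit (suc d) (λ i → isY {σ = σ} f y (colorAt f (n + 1 ∸ ln + i))) ≡ + d
      ≈⟨ lastHit≡max⇔ d _ ⟩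
    isY {σ = σ} f y (colorAt f (n + 1 ∸ ln + d)) ≡ true
      ≈⟨ isY≡true⇔ _ ⟩
    colorAt f (n + 1 ∸ ln + d) ≡ just y
      ≈⟨ mk⇔ (trans (sym same-color)) (trans same-color) ⟩
    colorAt (rev f) (ln ∸ d) ≡ just y
      ≈⟨ mk⇔ inj₂ [ (λ ln≤d → contradiction (s≤s ln≤d) ln≮1+d) , id ]′ ⟩
    (ln ≤ d ⊎ colorAt (rev f) (ln ∸ d) ≡ just y)
      ∎
    where
    open ⇔-Reasoning
    same-color : colorAt f (n + 1 ∸ ln + d) ≡ colorAt (rev f) (ln ∸ d)
    same-color = colorAt-rev f (ln ∸ d) (n + 1 ∸ ln + d)
      (trans ([n∸m]+[[o∸n]+m]≡o d≤ln ln≤n+1) (+-comm n 1))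
      where
      d≤ln : d ≤ ln
      d≤ln = ≤-trans (n≤1+n d) (≮⇒≥ ln≮1+d)
      ln≤n+1 : ln ≤ n + 1
      ln≤n+1 = subst (ln ≤_) (+-comm 1 n) ln≤1+n

  h≡⇔Unique : ∀ (u : Node) d → All (_≤ suc n) (leaves u) →
              h f y u (suc d) ≡ + d ⇔ Unique f y d u
  hE≡⇔Unique : ∀ (es : Edges) d → All (_≤ suc n) (leavesE es) →
               hE f y es (suc d) ≡ + d ⇔ Unique f y d (node es)
  h≡⇔Unique (leaf ln) d (ln≤1+n ∷ []) = mk⇔ ((_∷ []) ∘ to) (from ∘ singleton⁻)
    where open Equivalence (hLeaf≡⇔ d ln≤1+n)
  h≡⇔Unique (node es) = hE≡⇔Unique es
  hE≡⇔Unique [] d _ = mk⇔ (λ _ → []) (λ _ → refl)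
  hE≡⇔Unique ((l , t) ∷ es) d bounds with ++⁻ (leaves t) bounds
  ... | t-bounds , es-bounds = begin
    h f y t (suc d) ⊓ hE f y es (suc d) ≡ + d
      ≈⟨ ⊓≡upper⇔ (h≤ t d) (hE≤ es d) ⟩
    (h f y t (suc d) ≡ + d × hE f y es (suc d) ≡ + d)
      ≈⟨ h≡⇔Unique t d t-bounds ×-⇔ hE≡⇔Unique es d es-bounds ⟩
    (Unique f y d t × Unique {σ = σ} f y d (node es))
      ≈⟨ ↔⇒⇔ ++↔ ⟩
    Unique f y d (node ((l , t) ∷ es))
      ∎
    where open ⇔-Reasoning

lemma3 : (σ γ n : ℕ) (S : Fin n → Fin σ) (f : Fin n → Fin γ) (y : Fin γ)
         (T : Tree (Maybe (Fin σ))) → IsSuffixTree (revDollar S) T →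
         (u : Tree (Maybe (Fin σ))) → u ≼ T → (d : ℕ) →
         (h {σ = σ} f y u (suc d) ≡ + d) ⇔ Unique {σ = σ} f y d u
lemma3 σ γ n S f y T isST u u≼T d =
  h≡⇔Unique f y u d
    (subst (λ N → All (_≤ N) (leaves u)) (length-revDollar S) (suffixTree-leaves≤ isST u≼T))
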